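{- Let $a,b\ge2$ and let $K_{ab}=K_a+K_b$ be the graph obtained from the complete graphs $K_a$ on $[a]$ and $K_b$ by identifying vertex $a$ of the first with the first vertex of the second, so that it has $n=a+b-1$ vertices (vertex set $[n]$, edges all pairs within $[a]$ and all pairs within $\{a,\dots,n\}$). Then $$X_{K_{ab}}(\mathbf x;q)=[a-1]_q!\,[b-1]_q!\sum_{k=\max\{a,b\}}^{n}q^{n-k}[2k-n]_q\,e_{k}e_{n-k},$$ with the convention $e_0=1$.
   Context: $X_G(\mathbf x;q)=\sum_\kappa q^{\mathrm{asc}(\kappa)}x_{\kappa(1)}\cdots x_{\kappa(n)}$ over proper colourings $\kappa:[n]\to\{1,2,\dots\}$, where $\mathrm{asc}(\kappa)$ is the number of edges $\{i,j\}$ with $i<j$ and $\kappa(i)<\kappa(j)$. $e_k=\sum_{i_1<\dots<i_k}x_{i_1}\cdots x_{i_k}$. $[k]_q=1+q+\dots+q^{k-1}$, $[m]_q!=[m]_q[m-1]_q\cdots[1]_q$, $[0]_q!=1$. -}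

module Defs where

open import Algebra.Bundles using (CommutativeRing)
open import Data.Nat using (ℕ; zero; suc; _∸_; _≤ᵇ_; _<ᵇ_; _≡ᵇ_)
open import Data.Bool using (Bool; true; false; if_then_else_; _∧_; _∨_; not)
open import Data.Fin using (Fin; toℕ)
open import Data.Nat using () renaming (_+_ to _+ℕ_)
open import Data.Fin.Subset using (Subset; ∣_∣)
open import Data.Vec using (Vec; []; _∷_; lookup)
open import Data.List using (List; []; _∷_; map; concatMap; foldr; upTo; allFin; filter; length)
open import Data.Product using (_×_; _,_)
open import Relation.Nullary.Decidable using (⌊_⌋)
import Data.Fin as F

allVecs : ∀ {a} {A : Set a} → List A → (n : ℕ) → List (Vec A n)
allVecs xs zero    = [] ∷ []
allVecs xs (suc n) = concatMap (λ y → map (y ∷_) (allVecs xs n)) xs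

-- A simple graph on vertex set Fin n (0-based version of [n]):
-- G i j is consulted only for toℕ i < toℕ j, and says whether {i,j} is an edge.
Graph : ℕ → Set
Graph n = Fin n → Fin n → Bool

pairs : (n : ℕ) → List (Fin n × Fin n)
pairs n = concatMap (λ i → map (i ,_) (filter (λ j → toℕ i Data.Nat.<? toℕ j) (allFin n))) (allFin n)
  where import Data.Nat

-- K_a + K_b on [n], n = a + b - 1 (vertex v in [n] is Fin element with toℕ = v - 1):
-- {i<j} is an edge iff j ≤ a (both in [a]) or i ≥ a (both in {a,…,n}).
Kab : (a b : ℕ) → Graph (a +ℕ b ∸ 1)
Kab a b i j = (suc (toℕ j) ≤ᵇ a) ∨ (a ≤ᵇ suc (toℕ i))

-- colourings into the first N colours {1,…,N} (colour c ↔ Fin element with toℕ = c - 1)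
Colouring : ℕ → ℕ → Set
Colouring N n = Vec (Fin N) n

proper : ∀ {N n} → Graph n → Colouring N n → Bool
proper {n = n} G κ =
  foldr _∧_ true (map (λ { (i , j) → not (G i j) ∨ not ⌊ lookup κ i F.≟ lookup κ j ⌋ }) (pairs n))

asc : ∀ {N n} → Graph n → Colouring N n → ℕ
asc {n = n} G κ =
  length (filter (λ { (i , j) → Data.Bool._≟_ (G i j ∧ (toℕ (lookup κ i) <ᵇ toℕ (lookup κ j))) true }) (pairs n))
  where import Data.Bool

module _ {c ℓ} (R : CommutativeRing c ℓ) where
  open CommutativeRing R

  pow : Carrier → ℕ → Carrier
  pow q zero    = 1#
  pow q (suc m) = q * pow q m

  Σ : List Carrier → Carrier
  Σ = foldr _+_ 0#

  Π : List Carrier → Carrier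
  Π = foldr _*_ 1#

  ΣRange : ℕ → ℕ → (ℕ → Carrier) → Carrier
  ΣRange lo hi f = Σ (map f (filter (λ k → Data.Nat._≤?_ lo k) (upTo (suc hi))))
    where import Data.Nat

  -- X_G specialised to the N variables x_1,…,x_N (x_{i} = 0 for i > N), q ∈ R
  X : (N : ℕ) → (Fin N → Carrier) → Carrier → ∀ {n} → Graph n → Carrier
  X N x q {n} G =
    Σ (map (λ κ → if proper G κ
                    then pow q (asc G κ) * Π (map (λ i → x (lookup κ i)) (allFin n))
                    else 0#)
           (allVecs (allFin N) n))

  e : (N : ℕ) → (Fin N → Carrier) → ℕ → Carrier
  e N x k =
    Σ (map (λ (S : Subset N) → if ∣ S ∣ ≡ᵇ k
                    then Π (map (λ i → if lookup S i then x i else 1#) (allFin N))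
                    else 0#)
           (allVecs (true ∷ false ∷ []) N))

  qint : Carrier → ℕ → Carrier
  qint q k = Σ (map (pow q) (upTo k))

  qfact : Carrier → ℕ → Carrier
  qfact q zero    = 1#
  qfact q (suc m) = qint q (suc m) * qfact q m

-- X_G is a sum over colourings κ of Π_i x_{κ i} times a product over the edges {i < j} of
-- τ(κ i, κ j), where τ(y, z) is 0, q or 1 according as y = z, y < z or y > z.  Deleting the
-- first vertex replaces the variables x_z of its neighbours by x_z τ(y, z), y being its
-- colour.  For a complete graph this gives X_{K_m} = [m]_q! e_m by the insertion identity
-- Σ_y x_y e_m(x τ(y, ·)) = [m+1]_q e_{m+1}; deleting the vertices of K_a + K_b in order up
-- to the cut vertex a gives [a-1]_q! [b-1]_q! P(a, b), where
--   P(i, j) = Σ_c x_c e_{i-1}(x τ(·, c)) e_{j-1}(x τ(c, ·))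
-- sums over the colour c of the cut vertex.  Adjoining a new smallest variable acts on P by an
-- explicit bilinear operator, and induction on the number of variables gives
--   P(i, j+1) - P(i+1, j) = ([i]_q - [j]_q) e_i e_j,
-- whose case i = 0 is the insertion identity.  The right-hand side of the theorem satisfies
-- the same recurrence and, like P, vanishes at j = 0; these two properties determine P.

module Submission where

open import Defs
open import Algebra.Bundles using (CommutativeRing)
import Algebra.Solver.Ring
open import Algebra.Solver.Ring.AlmostCommutativeRing using (fromCommutativeRing; _-Raw-AlmostCommutative⟶_)
open import Data.Bool as Bool using (Bool; true; false; if_then_else_; _∧_; _∨_; not)
open import Data.Bool.Properties using (if-eta)
open import Data.Fin as Fin using (Fin; zero; suc; toℕ)
open import Data.Fin.Subset using (Subset; ∣_∣)
open import Data.Integer as ℤ using (ℤ; +_; -[1+_]; _⊖_; sign; _◃_)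
import Data.Integer.Properties as ℤ
open import Data.List using (List; []; _∷_; map; _++_; allFin; foldr; concatMap; filter; upTo; applyUpTo; length)
import Data.List.Properties as List
open import Data.Maybe as Maybe using (Maybe)
open import Data.Nat using (ℕ; zero; suc; _∸_; _≤_; _<_; _⊔_; _≡ᵇ_; _<ᵇ_; s≤s; compare; less; equal; greater)
  renaming (_+_ to _+ℕ_; _*_ to _*ℕ_)
open import Data.Nat.Properties as ℕ using (_≤?_; _<?_)
open import Data.Product as Product using (_,_; proj₁; proj₂)
open import Data.Sign as Sign using (Sign)
open import Data.Sum using (inj₁; inj₂)
open import Data.Vec using ([]; _∷_; lookup)
open import Function using (_∘_; id)
open import Relation.Binary.Consequences using (dec⇒weaklyDec)
open import Relation.Binary.PropositionalEquality as ≡ using (_≡_)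
open import Relation.Nullary using (¬_; yes; no; does)
open import Relation.Nullary.Decidable using (⌊_⌋)
open import Relation.Unary as U using (Pred)

-- The library's solvers for an arbitrary commutative ring take their coefficients in the ring
-- itself, where normal forms are not canonical; with coefficients in ℤ they are.
module IntegerCoefficientSolver {c ℓ} (R : CommutativeRing c ℓ) where
  open CommutativeRing R
  open import Algebra.Properties.Semiring.Mult.TCOptimised semiring using (_×_; 1+×; ×-homo-+; ×1-homo-*)
  open import Algebra.Properties.Ring ring using (-1*x≈-x; -0#≈0#; -‿involutive; -‿+-comm; xyx⁻¹≈y)
  open import Algebra.Properties.CommutativeSemigroup *-commutativeSemigroup using (interchange)
  open import Relation.Binary.Reasoning.Setoid setoid

  private
    -- With the optimised ℕ-action, ⟦ + 1 ⟧ reduces to 1#, so con (+ 1) stands for 1# in goals.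
    ⟦_⟧ : ℤ → Carrier
    ⟦ + n ⟧      = n × 1#
    ⟦ -[1+ n ] ⟧ = - (suc n × 1#)

    ⊖-homo : ∀ m n → ⟦ m ⊖ n ⟧ ≈ m × 1# - n × 1#
    ⊖-homo m       zero    = sym (trans (+-congˡ -0#≈0#) (+-identityʳ _))
    ⊖-homo zero    (suc n) = sym (+-identityˡ _)
    ⊖-homo (suc m) (suc n) = begin
      ⟦ suc m ⊖ suc n ⟧                 ≡⟨ ≡.cong ⟦_⟧ (ℤ.[1+m]⊖[1+n]≡m⊖n m n) ⟩
      ⟦ m ⊖ n ⟧                         ≈⟨ ⊖-homo m n ⟩
      m × 1# - n × 1#                   ≈⟨ +-congʳ (xyx⁻¹≈y 1# _) ⟨
      ((1# + m × 1#) - 1#) - n × 1#     ≈⟨ +-assoc _ _ _ ⟩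
      (1# + m × 1#) + (- 1# - n × 1#)   ≈⟨ +-congˡ (-‿+-comm 1# _) ⟩
      (1# + m × 1#) - (1# + n × 1#)     ≈⟨ +-cong (1+× m 1#) (-‿cong (1+× n 1#)) ⟨
      suc m × 1# - suc n × 1#           ∎

    +-homo : ∀ i j → ⟦ i ℤ.+ j ⟧ ≈ ⟦ i ⟧ + ⟦ j ⟧
    +-homo (+ m)      (+ n)      = ×-homo-+ 1# m n
    +-homo (+ m)      -[1+ n ]   = ⊖-homo m (suc n)
    +-homo -[1+ m ]   (+ n)      = trans (⊖-homo n (suc m)) (+-comm _ _)
    +-homo -[1+ m ]   -[1+ n ]   = begin
      - (suc (suc (m +ℕ n)) × 1#)       ≡⟨ ≡.cong (λ k → - (suc k × 1#)) (ℕ.+-suc m n) ⟨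
      - ((suc m +ℕ suc n) × 1#)         ≈⟨ -‿cong (×-homo-+ 1# (suc m) (suc n)) ⟩
      - (suc m × 1# + suc n × 1#)       ≈⟨ -‿+-comm _ _ ⟨
      - (suc m × 1#) + - (suc n × 1#)   ∎

    ⟦_⟧ₛ : Sign → Carrier
    ⟦ Sign.+ ⟧ₛ = 1#
    ⟦ Sign.- ⟧ₛ = - 1#

    ⟦⟧ₛ-homo : ∀ s t → ⟦ s Sign.* t ⟧ₛ ≈ ⟦ s ⟧ₛ * ⟦ t ⟧ₛ
    ⟦⟧ₛ-homo Sign.+ t      = sym (*-identityˡ _)
    ⟦⟧ₛ-homo Sign.- Sign.+ = sym (*-identityʳ _)
    ⟦⟧ₛ-homo Sign.- Sign.- = sym (trans (-1*x≈-x _) (-‿involutive 1#))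

    ◃-homo : ∀ s n → ⟦ s ◃ n ⟧ ≈ ⟦ s ⟧ₛ * n × 1#
    ◃-homo s      zero    = sym (zeroʳ _)
    ◃-homo Sign.+ (suc n) = sym (*-identityˡ _)
    ◃-homo Sign.- (suc n) = sym (-1*x≈-x _)

    sign-abs : ∀ i → ⟦ i ⟧ ≈ ⟦ sign i ⟧ₛ * ℤ.∣ i ∣ × 1#
    sign-abs i = trans (reflexive (≡.cong ⟦_⟧ (≡.sym (ℤ.◃-inverse i)))) (◃-homo (sign i) ℤ.∣ i ∣)

    *-homo : ∀ i j → ⟦ i ℤ.* j ⟧ ≈ ⟦ i ⟧ * ⟦ j ⟧
    *-homo i j = begin
      ⟦ (sign i Sign.* sign j) ◃ (ℤ.∣ i ∣ *ℕ ℤ.∣ j ∣) ⟧      ≈⟨ ◃-homo (sign i Sign.* sign j) (ℤ.∣ i ∣ *ℕ ℤ.∣ j ∣) ⟩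
      ⟦ sign i Sign.* sign j ⟧ₛ * (ℤ.∣ i ∣ *ℕ ℤ.∣ j ∣) × 1#
        ≈⟨ *-cong (⟦⟧ₛ-homo (sign i) (sign j)) (×1-homo-* ℤ.∣ i ∣ ℤ.∣ j ∣) ⟩
      (⟦ sign i ⟧ₛ * ⟦ sign j ⟧ₛ) * (ℤ.∣ i ∣ × 1# * ℤ.∣ j ∣ × 1#)  ≈⟨ interchange _ _ _ _ ⟩
      (⟦ sign i ⟧ₛ * ℤ.∣ i ∣ × 1#) * (⟦ sign j ⟧ₛ * ℤ.∣ j ∣ × 1#)  ≈⟨ *-cong (sign-abs i) (sign-abs j) ⟨
      ⟦ i ⟧ * ⟦ j ⟧                                         ∎

    -‿homo : ∀ i → ⟦ ℤ.- i ⟧ ≈ - ⟦ i ⟧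
    -‿homo (+ zero)  = sym -0#≈0#
    -‿homo (+ suc n) = refl
    -‿homo -[1+ n ]  = sym (-‿involutive _)

    homomorphism : ℤ.+-*-rawRing -Raw-AlmostCommutative⟶ fromCommutativeRing R
    homomorphism = record
      { ⟦_⟧    = ⟦_⟧
      ; +-homo = +-homo
      ; *-homo = *-homo
      ; -‿homo = -‿homo
      ; 0-homo = refl
      ; 1-homo = refl
      }

    ⟦⟧-dec : ∀ i j → Maybe (⟦ i ⟧ ≈ ⟦ j ⟧)
    ⟦⟧-dec i j = Maybe.map (λ { ≡.refl → refl }) (dec⇒weaklyDec ℤ._≟_ i j)

  open Algebra.Solver.Ring ℤ.+-*-rawRing (fromCommutativeRing R) homomorphism ⟦⟧-dec public
    using (solve; _:+_; _:*_; _:-_; :-_; _:=_; con)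

allFin-suc : ∀ n → allFin (suc n) ≡ zero ∷ map suc (allFin n)
allFin-suc n = ≡.cong (zero ∷_) (≡.sym (List.map-tabulate id suc))

map-allFin-suc : ∀ {a} {A : Set a} {n} (f : Fin (suc n) → A) →
                 map f (allFin (suc n)) ≡ f zero ∷ map (f ∘ suc) (allFin n)
map-allFin-suc {n = n} f = ≡.trans (≡.cong (map f) (allFin-suc n)) (≡.cong (f zero ∷_) (≡.sym (List.map-∘ (allFin n))))

private
  filter-zero< : ∀ {n} (A : List (Fin n)) → filter (λ j → toℕ {suc n} zero <? toℕ j) (map suc A) ≡ map suc A
  filter-zero< []      = ≡.refl
  filter-zero< (a ∷ A) = ≡.cong (suc a ∷_) (filter-zero< A)

  filter-suc< : ∀ {n} (i : Fin n) (A : List (Fin n)) →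
    filter (λ j → toℕ (suc i) <? toℕ j) (map suc A) ≡ map suc (filter (λ j → toℕ i <? toℕ j) A)
  filter-suc< i []      = ≡.refl
  filter-suc< i (a ∷ A) with toℕ i <ᵇ toℕ a
  ... | true  = ≡.cong (suc a ∷_) (filter-suc< i A)
  ... | false = filter-suc< i A

  pairsFrom : ∀ n → Fin n → List (Fin n Product.× Fin n)
  pairsFrom n i = map (i ,_) (filter (λ j → toℕ i <? toℕ j) (allFin n))

  pairsFrom-suc : ∀ n (i : Fin n) → pairsFrom (suc n) (suc i) ≡ map (Product.map suc suc) (pairsFrom n i)
  pairsFrom-suc n i = begin
    pairsFrom (suc n) (suc i)
      ≡⟨ ≡.cong (λ js → map (suc i ,_) (filter (λ j → toℕ (suc i) <? toℕ j) js)) (allFin-suc n) ⟩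
    map (suc i ,_) (filter (λ j → toℕ (suc i) <? toℕ j) (zero ∷ map suc (allFin n)))
      ≡⟨ ≡.cong (map (suc i ,_)) (filter-suc< i (allFin n)) ⟩
    map (suc i ,_) (map suc (filter (λ j → toℕ i <? toℕ j) (allFin n)))
      ≡⟨ List.map-∘ _ ⟨
    map (λ j → suc i , suc j) (filter (λ j → toℕ i <? toℕ j) (allFin n))
      ≡⟨ List.map-∘ _ ⟩
    map (Product.map suc suc) (pairsFrom n i) ∎
    where open ≡.≡-Reasoning

pairs-suc : ∀ n → pairs (suc n) ≡ map (λ j → zero , suc j) (allFin n) ++ map (Product.map suc suc) (pairs n)
pairs-suc n = begin
  concatMap (pairsFrom (suc n)) (allFin (suc n))
    ≡⟨ ≡.cong (concatMap (pairsFrom (suc n))) (allFin-suc n) ⟩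
  concatMap (pairsFrom (suc n)) (zero ∷ map suc (allFin n))
    ≡⟨ ≡.cong₂ _++_ first (List.concatMap-map (pairsFrom (suc n)) suc (allFin n)) ⟩
  map (λ j → zero , suc j) (allFin n) ++ concatMap (pairsFrom (suc n) ∘ suc) (allFin n)
    ≡⟨ ≡.cong (map (λ j → zero , suc j) (allFin n) ++_)
         (≡.trans (List.concatMap-cong (pairsFrom-suc n) (allFin n))
                  (≡.sym (List.map-concatMap (Product.map suc suc) (pairsFrom n) (allFin n)))) ⟩
  map (λ j → zero , suc j) (allFin n) ++ map (Product.map suc suc) (pairs n) ∎
  where
  open ≡.≡-Reasoning
  first : pairsFrom (suc n) zero ≡ map (λ j → zero , suc j) (allFin n)
  first = ≡.trans (≡.cong (λ js → map (zero ,_) (filter (λ j → toℕ {suc n} zero <? toℕ j) js)) (allFin-suc n))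
                  (≡.trans (≡.cong (map (zero ,_)) (filter-zero< (allFin n))) (≡.sym (List.map-∘ (allFin n))))

module _ {c ℓ} (R : CommutativeRing c ℓ) where
  open CommutativeRing R hiding (zero)
  open import Algebra.Properties.Semiring.Sum semiring using (sum; ∑-distrib-+; ∑-comm; *-distribˡ-sum; sum-cong-≋; sum-replicate-zero)
  open import Algebra.Properties.Ring ring using (-0#≈0#)
  open import Algebra.Properties.CommutativeSemigroup *-commutativeSemigroup using (x∙yz≈y∙xz; interchange)
  open import Relation.Binary.Reasoning.Setoid setoid
  open IntegerCoefficientSolver R

  Σ-++ : ∀ xs ys → Σ R (xs ++ ys) ≈ Σ R xs + Σ R ys
  Σ-++ []       ys = sym (+-identityˡ _)
  Σ-++ (x ∷ xs) ys = trans (+-congˡ (Σ-++ xs ys)) (sym (+-assoc _ _ _))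

  Σ-map-cong : ∀ {a} {A : Set a} (xs : List A) {f g : A → Carrier} →
               (∀ x → f x ≈ g x) → Σ R (map f xs) ≈ Σ R (map g xs)
  Σ-map-cong []       f≈g = refl
  Σ-map-cong (x ∷ xs) f≈g = +-cong (f≈g x) (Σ-map-cong xs f≈g)

  Σ-map-*ˡ : ∀ {a} {A : Set a} (xs : List A) k (f : A → Carrier) →
             Σ R (map (λ x → k * f x) xs) ≈ k * Σ R (map f xs)
  Σ-map-*ˡ []       k f = sym (zeroʳ k)
  Σ-map-*ˡ (x ∷ xs) k f = trans (+-congˡ (Σ-map-*ˡ xs k f)) (sym (distribˡ _ _ _))

  Σ-map-0# : ∀ {a} {A : Set a} (xs : List A) → Σ R (map (λ _ → 0#) xs) ≈ 0#
  Σ-map-0# []       = refl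
  Σ-map-0# (x ∷ xs) = trans (+-congˡ (Σ-map-0# xs)) (+-identityˡ 0#)

  Σ-concatMap : ∀ {a b} {A : Set a} {B : Set b} (g : A → List B) (f : B → Carrier) xs →
                Σ R (map f (concatMap g xs)) ≈ Σ R (map (λ x → Σ R (map f (g x))) xs)
  Σ-concatMap g f []       = refl
  Σ-concatMap g f (x ∷ xs) = begin
    Σ R (map f (g x ++ concatMap g xs))          ≡⟨ ≡.cong (Σ R) (List.map-++ f (g x) _) ⟩
    Σ R (map f (g x) ++ map f (concatMap g xs))  ≈⟨ Σ-++ (map f (g x)) _ ⟩
    Σ R (map f (g x)) + Σ R (map f (concatMap g xs)) ≈⟨ +-congˡ (Σ-concatMap g f xs) ⟩
    Σ R (map f (g x)) + Σ R (map (λ x → Σ R (map f (g x))) xs) ∎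

  Σ-allFin : ∀ {N} (f : Fin N → Carrier) → Σ R (map f (allFin N)) ≈ sum f
  Σ-allFin {zero}  f = refl
  Σ-allFin {suc N} f = trans (reflexive (≡.cong (Σ R) (map-allFin-suc f))) (+-congˡ (Σ-allFin (f ∘ suc)))

  Π-++ : ∀ xs ys → Π R (xs ++ ys) ≈ Π R xs * Π R ys
  Π-++ []       ys = sym (*-identityˡ _)
  Π-++ (x ∷ xs) ys = trans (*-congˡ (Π-++ xs ys)) (sym (*-assoc _ _ _))

  Π-map-cong : ∀ {a} {A : Set a} (xs : List A) {f g : A → Carrier} →
               (∀ x → f x ≈ g x) → Π R (map f xs) ≈ Π R (map g xs)
  Π-map-cong []       f≈g = refl
  Π-map-cong (x ∷ xs) f≈g = *-cong (f≈g x) (Π-map-cong xs f≈g)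

  Π-map-* : ∀ {a} {A : Set a} (xs : List A) (f g : A → Carrier) →
            Π R (map (λ x → f x * g x) xs) ≈ Π R (map f xs) * Π R (map g xs)
  Π-map-* []       f g = sym (*-identityˡ 1#)
  Π-map-* (x ∷ xs) f g = trans (*-congˡ (Π-map-* xs f g)) (interchange _ _ _ _)

  sum-zero : ∀ {N} {f : Fin N → Carrier} → (∀ c → f c ≈ 0#) → sum f ≈ 0#
  sum-zero {N} f≈0 = trans (sum-cong-≋ f≈0) (sum-replicate-zero N)

  ∑-*-+ : ∀ {N} a (f g : Fin N → Carrier) → sum (λ c → a * f c + g c) ≈ a * sum f + sum g
  ∑-*-+ a f g = trans (∑-distrib-+ (λ c → a * f c) g) (+-congʳ (sym (*-distribˡ-sum a f)))

  -- Elementary symmetric polynomials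

  -- shift u k = u (k - 1), with the value 0# at k = 0 (the convention e_{-1} = 0).
  shift : (ℕ → Carrier) → ℕ → Carrier
  shift u zero    = 0#
  shift u (suc k) = u k

  shift-cong : ∀ {u v} → (∀ k → u k ≈ v k) → ∀ k → shift u k ≈ shift v k
  shift-cong u≈v zero    = refl
  shift-cong u≈v (suc k) = u≈v k

  extend : Carrier → (ℕ → Carrier) → ℕ → Carrier
  extend A u k = A * shift u k + u k

  shift-extend : ∀ A u k → shift (extend A u) k ≈ extend A (shift u) k
  shift-extend A u zero    = sym (trans (+-identityʳ _) (zeroʳ A))
  shift-extend A u (suc k) = refl

  if-*ˡ : ∀ b a u → (if b then a * u else 0#) ≈ a * (if b then u else 0#)
  if-*ˡ true  a u = refl
  if-*ˡ false a u = sym (zeroʳ a)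

  private
    subsetTerm : ∀ N → (Fin N → Carrier) → ℕ → Subset N → Carrier
    subsetTerm N h k S =
      if ∣ S ∣ ≡ᵇ k then Π R (map (λ i → if lookup S i then h i else 1#) (allFin N)) else 0#

    subsetTerm-true : ∀ N h k S →
      subsetTerm (suc N) h (suc k) (true ∷ S) ≈ h zero * subsetTerm N (h ∘ suc) k S
    subsetTerm-true N h k S = begin
      subsetTerm (suc N) h (suc k) (true ∷ S)
        ≡⟨ ≡.cong (λ p → if ∣ S ∣ ≡ᵇ k then Π R p else 0#) (map-allFin-suc (λ i → if lookup (true ∷ S) i then h i else 1#)) ⟩
      (if ∣ S ∣ ≡ᵇ k then h zero * Π R (map (λ i → if lookup S i then h (suc i) else 1#) (allFin N)) else 0#)
        ≈⟨ if-*ˡ (∣ S ∣ ≡ᵇ k) _ _ ⟩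
      h zero * subsetTerm N (h ∘ suc) k S ∎

    subsetTerm-false : ∀ N h k S → subsetTerm (suc N) h k (false ∷ S) ≈ subsetTerm N (h ∘ suc) k S
    subsetTerm-false N h k S = begin
      subsetTerm (suc N) h k (false ∷ S)
        ≡⟨ ≡.cong (λ p → if ∣ S ∣ ≡ᵇ k then Π R p else 0#) (map-allFin-suc (λ i → if lookup (false ∷ S) i then h i else 1#)) ⟩
      (if ∣ S ∣ ≡ᵇ k then 1# * Π R (map (λ i → if lookup S i then h (suc i) else 1#) (allFin N)) else 0#)
        ≈⟨ if-*ˡ (∣ S ∣ ≡ᵇ k) _ _ ⟩
      1# * subsetTerm N (h ∘ suc) k S
        ≈⟨ *-identityˡ _ ⟩
      subsetTerm N (h ∘ suc) k S ∎

  e-peel : ∀ N (h : Fin (suc N) → Carrier) k → e R (suc N) h k ≈ extend (h zero) (e R N (h ∘ suc)) k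
  e-peel N h k = begin
    e R (suc N) h k
      ≈⟨ Σ-concatMap (λ b → map (b ∷_) subsets) (subsetTerm (suc N) h k) (true ∷ false ∷ []) ⟩
    Σ R (map (subsetTerm (suc N) h k) (map (true ∷_) subsets)) +
      (Σ R (map (subsetTerm (suc N) h k) (map (false ∷_) subsets)) + 0#)
      ≈⟨ +-cong (reflexive (≡.cong (Σ R) (≡.sym (List.map-∘ subsets))))
                (trans (+-identityʳ _) (reflexive (≡.cong (Σ R) (≡.sym (List.map-∘ subsets))))) ⟩
    Σ R (map (subsetTerm (suc N) h k ∘ (true ∷_)) subsets) +
      Σ R (map (subsetTerm (suc N) h k ∘ (false ∷_)) subsets)
      ≈⟨ +-cong (withHead k) (Σ-map-cong subsets (subsetTerm-false N h k)) ⟩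
    extend (h zero) (e R N (h ∘ suc)) k ∎
    where
    subsets = allVecs (true ∷ false ∷ []) N
    withHead : ∀ k → Σ R (map (subsetTerm (suc N) h k ∘ (true ∷_)) subsets) ≈ h zero * shift (e R N (h ∘ suc)) k
    withHead zero    = trans (Σ-map-0# subsets) (sym (zeroʳ _))
    withHead (suc k) = trans (Σ-map-cong subsets (subsetTerm-true N h k)) (Σ-map-*ˡ subsets _ _)

  e-empty : ∀ (h : Fin 0 → Carrier) k → e R 0 h (suc k) ≈ 0#
  e-empty h k = +-identityʳ 0#

  e-zero : ∀ N (h : Fin N → Carrier) → e R N h 0 ≈ 1#
  e-zero zero    h = +-identityʳ 1#
  e-zero (suc N) h = trans (e-peel N h 0) (trans (+-cong (zeroʳ _) (e-zero N (h ∘ suc))) (+-identityˡ 1#))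

  e-cong : ∀ N {h h′ : Fin N → Carrier} → (∀ i → h i ≈ h′ i) → ∀ k → e R N h k ≈ e R N h′ k
  e-cong zero    {h} {h′} h≈h′ zero    = trans (e-zero 0 h) (sym (e-zero 0 h′))
  e-cong zero    {h} {h′} h≈h′ (suc k) = trans (e-empty h k) (sym (e-empty h′ k))
  e-cong (suc N) {h} {h′} h≈h′ k = begin
    e R (suc N) h k                                       ≈⟨ e-peel N h k ⟩
    h zero * shift (e R N (h ∘ suc)) k + e R N (h ∘ suc) k
      ≈⟨ +-cong (*-cong (h≈h′ zero) (shift-cong (e-cong N (h≈h′ ∘ suc)) k)) (e-cong N (h≈h′ ∘ suc) k) ⟩
    h′ zero * shift (e R N (h′ ∘ suc)) k + e R N (h′ ∘ suc) k ≈⟨ e-peel N h′ k ⟨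
    e R (suc N) h′ k                                      ∎

  e-zero-head : ∀ N (h : Fin (suc N) → Carrier) → h zero ≈ 0# → ∀ k → e R (suc N) h k ≈ e R N (h ∘ suc) k
  e-zero-head N h h₀≈0 k = trans (e-peel N h k) (trans (+-congʳ (trans (*-congʳ h₀≈0) (zeroˡ _))) (+-identityˡ _))

  e-scale : ∀ N (h : Fin N → Carrier) a k → e R N (λ i → h i * a) k ≈ pow R a k * e R N h k
  e-scale zero    h a zero    = trans (e-zero 0 (λ i → h i * a)) (sym (trans (*-identityˡ _) (e-zero 0 h)))
  e-scale zero    h a (suc k) = trans (e-empty (λ i → h i * a) k) (sym (trans (*-congˡ (e-empty h k)) (zeroʳ _)))
  e-scale (suc N) h a k = begin
    e R (suc N) (λ i → h i * a) k  ≈⟨ e-peel N _ k ⟩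
    (h zero * a) * shift (e R N (λ i → h (suc i) * a)) k + e R N (λ i → h (suc i) * a) k
      ≈⟨ +-cong (shifted k) (e-scale N (h ∘ suc) a k) ⟩
    pow R a k * (h zero * shift (e R N (h ∘ suc)) k) + pow R a k * e R N (h ∘ suc) k ≈⟨ distribˡ _ _ _ ⟨
    pow R a k * (h zero * shift (e R N (h ∘ suc)) k + e R N (h ∘ suc) k) ≈⟨ *-congˡ (e-peel N h k) ⟨
    pow R a k * e R (suc N) h k ∎
    where
    shifted : ∀ k → (h zero * a) * shift (e R N (λ i → h (suc i) * a)) k ≈ pow R a k * (h zero * shift (e R N (h ∘ suc)) k)
    shifted zero    = trans (zeroʳ _) (sym (trans (*-congˡ (zeroʳ _)) (zeroʳ _)))
    shifted (suc k) = trans (*-congˡ (e-scale N (h ∘ suc) a k))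
      (solve 4 (λ x a p f → ((x :* a) :* (p :* f)) := ((a :* p) :* (x :* f))) refl (h zero) a (pow R a k) (e R N (h ∘ suc) k))

  shift₁ shift₂ : (ℕ → ℕ → Carrier) → ℕ → ℕ → Carrier
  shift₁ Q i j = shift (λ a → Q a j) i
  shift₂ Q i j = shift (Q i) j

  Δ : (ℕ → ℕ → Carrier) → ℕ → ℕ → Carrier
  Δ Q i j = Q i (suc j) - Q (suc i) j

  extend₂ : Carrier → Carrier → (ℕ → ℕ → Carrier) → ℕ → ℕ → Carrier
  extend₂ A B Q i j = (A * B) * shift₁ (shift₂ Q) i j + (A * shift₁ Q i j + (B * shift₂ Q i j + Q i j))

  extend₂-cong : ∀ A B {Q Q′} → (∀ i j → Q i j ≈ Q′ i j) → ∀ i j → extend₂ A B Q i j ≈ extend₂ A B Q′ i j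
  extend₂-cong A B Q≈Q′ i j =
    +-cong (*-congˡ (shift-cong (λ a → shift-cong (Q≈Q′ a) j) i))
      (+-cong (*-congˡ (shift-cong (λ a → Q≈Q′ a j) i)) (+-cong (*-congˡ (shift-cong (Q≈Q′ i) j)) (Q≈Q′ i j)))

  Δ-shift₁ : ∀ {Q} → (∀ j → Q 0 j ≈ 0#) → ∀ i j → Δ (shift₁ Q) i j ≈ shift₁ (Δ Q) i j
  Δ-shift₁ Q₀≈0 zero    j = trans (+-congˡ (trans (-‿cong (Q₀≈0 j)) -0#≈0#)) (+-identityʳ 0#)
  Δ-shift₁ Q₀≈0 (suc i) j = refl

  Δ-shift₂ : ∀ {Q} → (∀ i → Q i 0 ≈ 0#) → ∀ i j → Δ (shift₂ Q) i j ≈ shift₂ (Δ Q) i j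
  Δ-shift₂ Q₀≈0 i zero    = trans (+-cong (Q₀≈0 i) -0#≈0#) (+-identityʳ 0#)
  Δ-shift₂ Q₀≈0 i (suc j) = refl

  Δ-extend₂ : ∀ A B {Q} → (∀ j → Q 0 j ≈ 0#) → (∀ i → Q i 0 ≈ 0#) →
              ∀ i j → Δ (extend₂ A B Q) i j ≈ extend₂ A B (Δ Q) i j
  Δ-extend₂ A B {Q} Q0j≈0 Qi0≈0 i j = begin
    Δ (extend₂ A B Q) i j
      ≈⟨ solve 10 (λ A B a a′ b b′ c c′ d d′ →
           (A :* B) :* a :+ (A :* b :+ (B :* c :+ d)) :- ((A :* B) :* a′ :+ (A :* b′ :+ (B :* c′ :+ d′)))
           := (A :* B) :* (a :- a′) :+ (A :* (b :- b′) :+ (B :* (c :- c′) :+ (d :- d′)))) refl A B _ _ _ _ _ _ _ _ ⟩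
    (A * B) * Δ (shift₁ (shift₂ Q)) i j + (A * Δ (shift₁ Q) i j + (B * Δ (shift₂ Q) i j + Δ Q i j))
      ≈⟨ +-cong (*-congˡ Δ₁₂) (+-cong (*-congˡ (Δ-shift₁ {Q} Q0j≈0 i j)) (+-congʳ (*-congˡ (Δ-shift₂ {Q} Qi0≈0 i j)))) ⟩
    extend₂ A B (Δ Q) i j ∎
    where
    shift₂Q0j≈0 : ∀ j → shift₂ Q 0 j ≈ 0#
    shift₂Q0j≈0 zero    = refl
    shift₂Q0j≈0 (suc j) = Q0j≈0 j
    Δ₁₂ : Δ (shift₁ (shift₂ Q)) i j ≈ shift₁ (shift₂ (Δ Q)) i j
    Δ₁₂ = trans (Δ-shift₁ {shift₂ Q} shift₂Q0j≈0 i j) (shift-cong (λ a → Δ-shift₂ {Q} Qi0≈0 a j) i)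

  Δ-unique : ∀ {Q Q′} → (∀ i → Q i 0 ≈ 0#) → (∀ i → Q′ i 0 ≈ 0#) → (∀ i j → Δ Q i j ≈ Δ Q′ i j) →
             ∀ i j → Q i j ≈ Q′ i j
  Δ-unique {Q} {Q′} Q≈0 Q′≈0 ΔQ≈ΔQ′ i zero    = trans (Q≈0 i) (sym (Q′≈0 i))
  Δ-unique {Q} {Q′} Q≈0 Q′≈0 ΔQ≈ΔQ′ i (suc j) = begin
    Q i (suc j)              ≈⟨ solve 2 (λ a b → a := b :+ (a :- b)) refl _ (Q (suc i) j) ⟩
    Q (suc i) j + Δ Q i j    ≈⟨ +-cong (Δ-unique {Q} {Q′} Q≈0 Q′≈0 ΔQ≈ΔQ′ (suc i) j) (ΔQ≈ΔQ′ i j) ⟩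
    Q′ (suc i) j + Δ Q′ i j  ≈⟨ solve 2 (λ a b → a := b :+ (a :- b)) refl _ (Q′ (suc i) j) ⟨
    Q′ i (suc j)             ∎

  ΣRange-snoc : ∀ lo hi f → ΣRange R lo (suc hi) f ≈ ΣRange R lo hi f + Σ R (map f (filter (lo ≤?_) (suc hi ∷ [])))
  ΣRange-snoc lo hi f = begin
    Σ R (map f (filter (lo ≤?_) (upTo (suc (suc hi)))))
      ≡⟨ ≡.cong (λ ks → Σ R (map f (filter (lo ≤?_) ks))) (≡.sym (List.upTo-∷ʳ (suc hi))) ⟩
    Σ R (map f (filter (lo ≤?_) (upTo (suc hi) ++ suc hi ∷ [])))
      ≡⟨ ≡.cong (Σ R ∘ map f) (List.filter-++ (lo ≤?_) (upTo (suc hi)) _) ⟩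
    Σ R (map f (filter (lo ≤?_) (upTo (suc hi)) ++ filter (lo ≤?_) (suc hi ∷ [])))
      ≡⟨ ≡.cong (Σ R) (List.map-++ f (filter (lo ≤?_) (upTo (suc hi))) _) ⟩
    Σ R (map f (filter (lo ≤?_) (upTo (suc hi))) ++ map f (filter (lo ≤?_) (suc hi ∷ [])))
      ≈⟨ Σ-++ (map f (filter (lo ≤?_) (upTo (suc hi)))) _ ⟩
    ΣRange R lo hi f + Σ R (map f (filter (lo ≤?_) (suc hi ∷ []))) ∎

  ΣRange-suc : ∀ lo hi f → lo ≤ suc hi → ΣRange R lo (suc hi) f ≈ ΣRange R lo hi f + f (suc hi)
  ΣRange-suc lo hi f lo≤ = trans (ΣRange-snoc lo hi f)
    (+-congˡ (trans (reflexive (≡.cong (Σ R ∘ map f) (List.filter-accept (lo ≤?_) lo≤))) (+-identityʳ _)))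

  ΣRange-suc-≰ : ∀ lo hi f → ¬ lo ≤ suc hi → ΣRange R lo (suc hi) f ≈ ΣRange R lo hi f
  ΣRange-suc-≰ lo hi f lo≰ = trans (ΣRange-snoc lo hi f)
    (trans (+-congˡ (reflexive (≡.cong (Σ R ∘ map f) (List.filter-reject (lo ≤?_) lo≰)))) (+-identityʳ _))

  ΣRange-empty : ∀ lo hi f → hi < lo → ΣRange R lo hi f ≈ 0#
  ΣRange-empty (suc lo) zero     f hi<lo = refl
  ΣRange-empty lo       (suc hi) f hi<lo =
    trans (ΣRange-suc-≰ lo hi f (ℕ.<⇒≱ hi<lo)) (ΣRange-empty lo hi f (ℕ.<-trans (ℕ.n<1+n hi) hi<lo))

  ΣRange-split : ∀ lo hi f → lo ≤ hi → ΣRange R lo hi f ≈ f lo + ΣRange R (suc lo) hi f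
  ΣRange-split zero zero     f lo≤hi = +-congˡ refl
  ΣRange-split lo   (suc hi) f lo≤hi with ℕ.m≤n⇒m<n∨m≡n lo≤hi
  ... | inj₁ (s≤s lo≤hi′) = begin
    ΣRange R lo (suc hi) f                     ≈⟨ ΣRange-suc lo hi f lo≤hi ⟩
    ΣRange R lo hi f + f (suc hi)              ≈⟨ +-congʳ (ΣRange-split lo hi f lo≤hi′) ⟩
    (f lo + ΣRange R (suc lo) hi f) + f (suc hi) ≈⟨ +-assoc _ _ _ ⟩
    f lo + (ΣRange R (suc lo) hi f + f (suc hi)) ≈⟨ +-congˡ (ΣRange-suc (suc lo) hi f (s≤s lo≤hi′)) ⟨
    f lo + ΣRange R (suc lo) (suc hi) f        ∎
  ... | inj₂ ≡.refl = begin
    ΣRange R (suc hi) (suc hi) f               ≈⟨ ΣRange-suc (suc hi) hi f lo≤hi ⟩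
    ΣRange R (suc hi) hi f + f (suc hi)        ≈⟨ +-congʳ (ΣRange-empty (suc hi) hi f ℕ.≤-refl) ⟩
    0# + f (suc hi)                            ≈⟨ +-comm _ _ ⟩
    f (suc hi) + 0#                            ≈⟨ +-congˡ (ΣRange-empty (suc (suc hi)) (suc hi) f ℕ.≤-refl) ⟨
    f (suc hi) + ΣRange R (suc (suc hi)) (suc hi) f ∎

  pairing : ∀ {N} → (Fin N → Carrier) → (u v : Fin N → ℕ → Carrier) → ℕ → ℕ → Carrier
  pairing h u v i j = sum (λ c → h c * (u c i * v c j))

  pairing-cong : ∀ {N} (h : Fin N → Carrier) {u u′ v v′ : Fin N → ℕ → Carrier} →
                 (∀ c k → u c k ≈ u′ c k) → (∀ c k → v c k ≈ v′ c k) →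
                 ∀ i j → pairing h u v i j ≈ pairing h u′ v′ i j
  pairing-cong h u≈u′ v≈v′ i j = sum-cong-≋ (λ c → *-congˡ (*-cong (u≈u′ c i) (v≈v′ c j)))

  pairing-shiftˡ : ∀ {N} (h : Fin N → Carrier) u v i j →
                   pairing h (λ c → shift (u c)) v i j ≈ shift₁ (pairing h u v) i j
  pairing-shiftˡ h u v zero    j = sum-zero (λ c → trans (*-congˡ (zeroˡ (v c j))) (zeroʳ (h c)))
  pairing-shiftˡ h u v (suc i) j = refl

  pairing-shiftʳ : ∀ {N} (h : Fin N → Carrier) u v i j →
                   pairing h u (λ c → shift (v c)) i j ≈ shift₂ (pairing h u v) i j
  pairing-shiftʳ h u v i zero    = sum-zero (λ c → trans (*-congˡ (zeroʳ (u c i))) (zeroʳ (h c)))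
  pairing-shiftʳ h u v i (suc j) = refl

  pairing-extend : ∀ {N} (h : Fin N → Carrier) A B (u v : Fin N → ℕ → Carrier) i j →
                   pairing h (λ c → extend A (u c)) (λ c → extend B (v c)) i j ≈ extend₂ A B (pairing h u v) i j
  pairing-extend h A B u v i j = begin
    sum (λ c → h c * (extend A (u c) i * extend B (v c) j))
      ≈⟨ sum-cong-≋ (λ c → solve 7 (λ h A B x y z w →
           h :* ((A :* x :+ y) :* (B :* z :+ w))
           := (A :* B) :* (h :* (x :* z)) :+ (A :* (h :* (x :* w)) :+ (B :* (h :* (y :* z)) :+ h :* (y :* w))))
           refl (h c) A B _ _ _ _) ⟩
    sum (λ c → (A * B) * puv c + (A * pu c + (B * pv c + p c)))
      ≈⟨ trans (∑-*-+ (A * B) puv _) (+-congˡ (trans (∑-*-+ A pu _) (+-congˡ (∑-*-+ B pv p)))) ⟩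
    (A * B) * sum puv + (A * sum pu + (B * sum pv + sum p))
      ≈⟨ +-cong (*-congˡ (trans (pairing-shiftˡ h u (λ c → shift (v c)) i j) (shift-cong (λ a → pairing-shiftʳ h u v a j) i)))
           (+-cong (*-congˡ (pairing-shiftˡ h u v i j)) (+-congʳ (*-congˡ (pairing-shiftʳ h u v i j)))) ⟩
    extend₂ A B (pairing h u v) i j ∎
    where
    puv pu pv p : Fin _ → Carrier
    puv c = h c * (shift (u c) i * shift (v c) j)
    pu  c = h c * (shift (u c) i * v c j)
    pv  c = h c * (u c i * shift (v c) j)
    p   c = h c * (u c i * v c j)

  module _ (q : Carrier) where

    -- q-integers

    private
      Σ-pow-suc : ∀ k f → Σ R (map (pow R q) (applyUpTo (suc ∘ f) k)) ≈ q * Σ R (map (pow R q) (applyUpTo f k))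
      Σ-pow-suc zero    f = sym (zeroʳ q)
      Σ-pow-suc (suc k) f = trans (+-congˡ (Σ-pow-suc k (f ∘ suc))) (sym (distribˡ _ _ _))

    qint-suc : ∀ k → qint R q (suc k) ≈ 1# + q * qint R q k
    qint-suc k = +-congˡ (Σ-pow-suc k id)

    qint-sucʳ : ∀ k → qint R q (suc k) ≈ qint R q k + pow R q k
    qint-sucʳ zero    = trans (+-identityʳ 1#) (sym (+-identityˡ 1#))
    qint-sucʳ (suc k) = begin
      qint R q (suc (suc k))                  ≈⟨ qint-suc (suc k) ⟩
      1# + q * qint R q (suc k)               ≈⟨ +-congˡ (*-congˡ (qint-sucʳ k)) ⟩
      1# + q * (qint R q k + pow R q k)
        ≈⟨ solve 3 (λ q a b → con (+ 1) :+ q :* (a :+ b) := (con (+ 1) :+ q :* a) :+ q :* b) refl q _ _ ⟩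
      (1# + q * qint R q k) + q * pow R q k   ≈⟨ +-congʳ (qint-suc k) ⟨
      qint R q (suc k) + pow R q (suc k)      ∎

    qint-+ : ∀ m k → qint R q (m +ℕ k) ≈ qint R q m + pow R q m * qint R q k
    qint-+ zero    k = sym (trans (+-identityˡ _) (*-identityˡ _))
    qint-+ (suc m) k = begin
      qint R q (suc (m +ℕ k))                          ≈⟨ qint-suc (m +ℕ k) ⟩
      1# + q * qint R q (m +ℕ k)                       ≈⟨ +-congˡ (*-congˡ (qint-+ m k)) ⟩
      1# + q * (qint R q m + pow R q m * qint R q k)
        ≈⟨ solve 4 (λ q a p b → con (+ 1) :+ q :* (a :+ p :* b) := (con (+ 1) :+ q :* a) :+ (q :* p) :* b)
                   refl q (qint R q m) (pow R q m) (qint R q k) ⟩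
      (1# + q * qint R q m) + pow R q (suc m) * qint R q k ≈⟨ +-congʳ (qint-suc m) ⟨
      qint R q (suc m) + pow R q (suc m) * qint R q k  ∎

    qdiff : ℕ → ℕ → Carrier
    qdiff i j = qint R q i - qint R q j

    qdiff-self : ∀ i → qdiff i i ≈ 0#
    qdiff-self i = -‿inverseʳ _

    qdiff-suc-suc : ∀ i j → qdiff (suc i) (suc j) ≈ q * qdiff i j
    qdiff-suc-suc i j = begin
      qint R q (suc i) - qint R q (suc j)             ≈⟨ +-cong (qint-suc i) (-‿cong (qint-suc j)) ⟩
      (1# + q * qint R q i) - (1# + q * qint R q j)
        ≈⟨ solve 3 (λ q a b → (con (+ 1) :+ q :* a) :- (con (+ 1) :+ q :* b) := q :* (a :- b)) refl q _ _ ⟩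
      q * qdiff i j                                   ∎

    qdiff-sucˡ : ∀ i j → qdiff (suc i) j ≈ pow R q j + q * qdiff i j
    qdiff-sucˡ i j = begin
      qint R q (suc i) - qint R q j                        ≈⟨ +-congʳ (qint-suc i) ⟩
      (1# + q * qint R q i) - qint R q j
        ≈⟨ solve 3 (λ q a b → (con (+ 1) :+ q :* a) :- b := ((con (+ 1) :+ q :* b) :- b) :+ q :* (a :- b)) refl q _ _ ⟩
      ((1# + q * qint R q j) - qint R q j) + q * qdiff i j  ≈⟨ +-congʳ (+-congʳ (trans (sym (qint-suc j)) (qint-sucʳ j))) ⟩
      ((qint R q j + pow R q j) - qint R q j) + q * qdiff i j
        ≈⟨ solve 3 (λ b p d → ((b :+ p) :- b) :+ d := p :+ d) refl _ _ _ ⟩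
      pow R q j + q * qdiff i j                            ∎

    qdiff-sucʳ : ∀ i j → qdiff i (suc j) ≈ qdiff i j - pow R q j
    qdiff-sucʳ i j = begin
      qint R q i - qint R q (suc j)            ≈⟨ +-congˡ (-‿cong (qint-sucʳ j)) ⟩
      qint R q i - (qint R q j + pow R q j)    ≈⟨ solve 3 (λ a b p → a :- (b :+ p) := (a :- b) :- p) refl _ _ _ ⟩
      qdiff i j - pow R q j                    ∎

    qdiff-+ˡ : ∀ j t → qdiff (j +ℕ t) j ≈ pow R q j * qint R q t
    qdiff-+ˡ j t = begin
      qint R q (j +ℕ t) - qint R q j                      ≈⟨ +-congʳ (qint-+ j t) ⟩
      (qint R q j + pow R q j * qint R q t) - qint R q j  ≈⟨ solve 2 (λ a b → (a :+ b) :- a := b) refl _ _ ⟩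
      pow R q j * qint R q t                              ∎

    qdiff-+ʳ : ∀ j t → qdiff j (j +ℕ t) ≈ - (pow R q j * qint R q t)
    qdiff-+ʳ j t = begin
      qint R q j - qint R q (j +ℕ t)                      ≈⟨ +-congˡ (-‿cong (qint-+ j t)) ⟩
      qint R q j - (qint R q j + pow R q j * qint R q t)  ≈⟨ solve 2 (λ a b → a :- (a :+ b) := :- b) refl _ _ ⟩
      - (pow R q j * qint R q t)                          ∎

    -- After expanding extend X f = X · shift f + f, the terms in shift f i · shift f j,
    -- shift f i · f j and f i · shift f j are matched by both-shifted, first-shifted and
    -- second-shifted respectively.
    qdiff-extend : ∀ X (f : ℕ → Carrier) i j →
      X * (shift f i * (pow R q j * f j) - f i * shift (λ k → pow R q k * f k) j)
        + extend₂ (X * q) X (λ a b → qdiff a b * (f a * f b)) i j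
      ≈ qdiff i j * (extend X f i * extend X f j)
    qdiff-extend X f i j = begin
      X * (shift f i * (pow R q j * f j) - f i * shift g j)
        + ((X * q) * X * shift₁ (shift₂ T) i j + (X * q * shift₁ T i j + (X * shift₂ T i j + T i j)))
        ≈⟨ solve 11 (λ X q sfi fi pj fj sgj S₁₂ S₁ S₂ T →
             X :* (sfi :* (pj :* fj) :- fi :* sgj) :+ ((X :* q) :* X :* S₁₂ :+ (X :* q :* S₁ :+ (X :* S₂ :+ T)))
             := X :* X :* (q :* S₁₂) :+ (X :* (pj :* (sfi :* fj) :+ q :* S₁) :+ (X :* (S₂ :- fi :* sgj) :+ T)))
             refl X q (shift f i) (f i) (pow R q j) (f j) (shift g j) _ _ _ _ ⟩
      X * X * (q * shift₁ (shift₂ T) i j)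
        + (X * (pow R q j * (shift f i * f j) + q * shift₁ T i j) + (X * (shift₂ T i j - f i * shift g j) + T i j))
        ≈⟨ +-cong (*-congˡ (both-shifted i j)) (+-cong (*-congˡ (first-shifted i)) (+-congʳ (*-congˡ (second-shifted j)))) ⟩
      X * X * (qdiff i j * (shift f i * shift f j))
        + (X * (qdiff i j * (shift f i * f j)) + (X * (qdiff i j * (f i * shift f j)) + qdiff i j * (f i * f j)))
        ≈⟨ solve 6 (λ X d sfi fi sfj fj →
             X :* X :* (d :* (sfi :* sfj)) :+ (X :* (d :* (sfi :* fj)) :+ (X :* (d :* (fi :* sfj)) :+ d :* (fi :* fj)))
             := d :* ((X :* sfi :+ fi) :* (X :* sfj :+ fj))) refl X (qdiff i j) (shift f i) (f i) (shift f j) (f j) ⟩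
      qdiff i j * (extend X f i * extend X f j) ∎
      where
      g : ℕ → Carrier
      g k = pow R q k * f k
      T : ℕ → ℕ → Carrier
      T a b = qdiff a b * (f a * f b)
      both-shifted : ∀ i j → q * shift₁ (shift₂ T) i j ≈ qdiff i j * (shift f i * shift f j)
      both-shifted zero    j       = solve 3 (λ q d y → q :* con (+ 0) := d :* (con (+ 0) :* y)) refl q _ _
      both-shifted (suc a) zero    = solve 3 (λ q d y → q :* con (+ 0) := d :* (y :* con (+ 0))) refl q _ _
      both-shifted (suc a) (suc b) = trans (sym (*-assoc _ _ _)) (*-congʳ (sym (qdiff-suc-suc a b)))
      first-shifted : ∀ i → pow R q j * (shift f i * f j) + q * shift₁ T i j ≈ qdiff i j * (shift f i * f j)
      first-shifted zero    = solve 4 (λ p q d y → p :* (con (+ 0) :* y) :+ q :* con (+ 0) := d :* (con (+ 0) :* y)) refl _ q _ _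
      first-shifted (suc a) = trans
        (solve 4 (λ p q d F → p :* F :+ q :* (d :* F) := (p :+ q :* d) :* F) refl _ q _ _)
        (*-congʳ (sym (qdiff-sucˡ a j)))
      second-shifted : ∀ j → shift₂ T i j - f i * shift g j ≈ qdiff i j * (f i * shift f j)
      second-shifted zero    = solve 3 (λ x d y → con (+ 0) :- x :* con (+ 0) := d :* (y :* con (+ 0))) refl _ _ _
      second-shifted (suc b) = trans
        (solve 4 (λ d p x y → d :* (x :* y) :- x :* (p :* y) := (d :- p) :* (x :* y)) refl _ _ (f i) (f b))
        (*-congʳ (sym (qdiff-sucʳ i b)))

    -- Insertion sums

    -- ascWeight y z is the factor contributed by an edge {i < j} coloured κ i = y, κ j = z:
    -- 0 if the colouring is improper on it, q if it is an ascent, 1 otherwise.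
    ascWeight : ∀ {N} → Fin N → Fin N → Carrier
    ascWeight zero    zero    = 0#
    ascWeight zero    (suc z) = q
    ascWeight (suc y) zero    = 1#
    ascWeight (suc y) (suc z) = ascWeight y z

    eLeft eRight : ∀ N → (Fin N → Carrier) → Fin N → ℕ → Carrier
    eLeft  N h c = e R N (λ y → h y * ascWeight y c)
    eRight N h c = e R N (λ y → h y * ascWeight c y)

    -- The shift by one makes it vanish for i = 0 and for j = 0, so that its recurrence
    -- (insertionSum-Δ) holds for all i, j without boundary cases.
    insertionSum : ∀ N → (Fin N → Carrier) → ℕ → ℕ → Carrier
    insertionSum N h = pairing h (λ c → shift (eLeft N h c)) (λ c → shift (eRight N h c))

    insertionSum-zeroˡ : ∀ N h j → insertionSum N h 0 j ≈ 0#
    insertionSum-zeroˡ N h = pairing-shiftˡ h (eLeft N h) (λ c → shift (eRight N h c)) 0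

    insertionSum-zeroʳ : ∀ N h i → insertionSum N h i 0 ≈ 0#
    insertionSum-zeroʳ N h i = pairing-shiftʳ h (λ c → shift (eLeft N h c)) (eRight N h) i 0

    insertionSum-peel : ∀ N (h : Fin (suc N) → Carrier) i j →
      insertionSum (suc N) h i j ≈
        h zero * (shift (e R N (h ∘ suc)) i * shift (λ k → pow R q k * e R N (h ∘ suc) k) j)
          + extend₂ (h zero * q) (h zero) (insertionSum N (h ∘ suc)) i j
    insertionSum-peel N h i j = +-cong (*-congˡ (*-cong (shift-cong ρ₀ i) (shift-cong σ₀ j))) (begin
      pairing h′ (λ c → shift (ρ (suc c))) (λ c → shift (σ (suc c))) i j
        ≈⟨ pairing-cong h′ (λ c k → trans (shift-cong (ρ-peel c) k) (shift-extend _ (ρ′ c) k))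
                           (λ c k → trans (shift-cong (σ-peel c) k) (shift-extend _ (σ′ c) k)) i j ⟩
      pairing h′ (λ c → extend (h zero * q) (shift (ρ′ c))) (λ c → extend (h zero) (shift (σ′ c))) i j
        ≈⟨ pairing-extend h′ (h zero * q) (h zero) _ _ i j ⟩
      extend₂ (h zero * q) (h zero) (insertionSum N h′) i j ∎)
      where
      h′ = h ∘ suc
      ρ σ : Fin (suc N) → ℕ → Carrier
      ρ = eLeft (suc N) h
      σ = eRight (suc N) h
      ρ′ σ′ : Fin N → ℕ → Carrier
      ρ′ = eLeft N h′
      σ′ = eRight N h′
      ρ₀ : ∀ k → ρ zero k ≈ e R N h′ k
      ρ₀ k = trans (e-zero-head N _ (zeroʳ (h zero)) k) (e-cong N (λ y → *-identityʳ (h′ y)) k)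
      σ₀ : ∀ k → σ zero k ≈ pow R q k * e R N h′ k
      σ₀ k = trans (e-zero-head N _ (zeroʳ (h zero)) k) (e-scale N h′ q k)
      ρ-peel : ∀ c k → ρ (suc c) k ≈ extend (h zero * q) (ρ′ c) k
      ρ-peel c = e-peel N _
      σ-peel : ∀ c k → σ (suc c) k ≈ extend (h zero) (σ′ c) k
      σ-peel c k = trans (e-peel N _ k) (+-congʳ (*-congʳ (*-identityʳ (h zero))))

    qdiff-e-empty : ∀ (h : Fin 0 → Carrier) i j → qdiff i j * (e R 0 h i * e R 0 h j) ≈ 0#
    qdiff-e-empty h zero    zero    = trans (*-congʳ (qdiff-self 0)) (zeroˡ _)
    qdiff-e-empty h i       (suc j) = trans (*-congˡ (trans (*-congˡ (e-empty h j)) (zeroʳ _))) (zeroʳ _)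
    qdiff-e-empty h (suc i) zero    = trans (*-congˡ (trans (*-congʳ (e-empty h i)) (zeroˡ _))) (zeroʳ _)

    insertionSum-Δ : ∀ N h i j → Δ (insertionSum N h) i j ≈ qdiff i j * (e R N h i * e R N h j)
    insertionSum-Δ zero    h i j = trans (+-congˡ -0#≈0#) (trans (+-identityʳ 0#) (sym (qdiff-e-empty h i j)))
    insertionSum-Δ (suc N) h i j = begin
      Δ (insertionSum (suc N) h) i j
        ≈⟨ +-cong (insertionSum-peel N h i (suc j)) (-‿cong (insertionSum-peel N h (suc i) j)) ⟩
      (x₀ * (shift f i * g j) + E i (suc j)) - (x₀ * (f i * shift g j) + E (suc i) j)
        ≈⟨ solve 5 (λ x₀ a b x y → (x₀ :* a :+ x) :- (x₀ :* b :+ y) := x₀ :* (a :- b) :+ (x :- y)) refl x₀ _ _ _ _ ⟩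
      x₀ * (shift f i * g j - f i * shift g j) + Δ E i j
        ≈⟨ +-congˡ (Δ-extend₂ (x₀ * q) x₀ {insertionSum N h′} (insertionSum-zeroˡ N h′) (insertionSum-zeroʳ N h′) i j) ⟩
      x₀ * (shift f i * g j - f i * shift g j) + extend₂ (x₀ * q) x₀ (Δ (insertionSum N h′)) i j
        ≈⟨ +-congˡ (extend₂-cong (x₀ * q) x₀ (insertionSum-Δ N h′) i j) ⟩
      x₀ * (shift f i * g j - f i * shift g j) + extend₂ (x₀ * q) x₀ (λ a b → qdiff a b * (f a * f b)) i j
        ≈⟨ qdiff-extend x₀ f i j ⟩
      qdiff i j * (extend x₀ f i * extend x₀ f j)
        ≈⟨ *-congˡ (*-cong (e-peel N h i) (e-peel N h j)) ⟨
      qdiff i j * (e R (suc N) h i * e R (suc N) h j) ∎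
      where
      x₀ = h zero
      h′ = h ∘ suc
      f g : ℕ → Carrier
      f = e R N h′
      g k = pow R q k * f k
      E : ℕ → ℕ → Carrier
      E = extend₂ (x₀ * q) x₀ (insertionSum N h′)

    insertion : ∀ N (h : Fin N → Carrier) m → sum (λ y → h y * eRight N h y m) ≈ qint R q (suc m) * e R N h (suc m)
    insertion N h m = begin
      sum (λ y → h y * eRight N h y m)
        ≈⟨ sum-cong-≋ (λ y → *-congˡ (trans (sym (*-identityˡ _)) (*-congʳ (sym (e-zero N (λ z → h z * ascWeight z y)))))) ⟩
      insertionSum N h 1 (suc m)
        ≈⟨ solve 2 (λ a b → b := a :- (a :- b)) refl (insertionSum N h 0 (suc (suc m))) _ ⟩
      insertionSum N h 0 (suc (suc m)) - Δ (insertionSum N h) 0 (suc m)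
        ≈⟨ +-cong (insertionSum-zeroˡ N h (suc (suc m))) (-‿cong (trans (insertionSum-Δ N h 0 (suc m)) (*-congˡ (*-congʳ (e-zero N h))))) ⟩
      0# - qdiff 0 (suc m) * (1# * e R N h (suc m))
        ≈⟨ solve 2 (λ Q E → con (+ 0) :- (con (+ 0) :- Q) :* (con (+ 1) :* E) := Q :* E) refl _ _ ⟩
      qint R q (suc m) * e R N h (suc m) ∎

    -- The closed form

    closedTerm : ∀ N → (Fin N → Carrier) → ℕ → ℕ → Carrier
    closedTerm N x n k = (pow R q (n ∸ k) * qint R q (2 *ℕ k ∸ n)) * (e R N x k * e R N x (n ∸ k))

    closedForm : ∀ N → (Fin N → Carrier) → ℕ → ℕ → Carrier
    closedForm N x i j = ΣRange R (i ⊔ j) (i +ℕ j ∸ 1) (closedTerm N x (i +ℕ j ∸ 1))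

    closedTerm-+ : ∀ N x k m → closedTerm N x (k +ℕ m) k ≈ (pow R q m * qint R q (k ∸ m)) * (e R N x k * e R N x m)
    closedTerm-+ N x k m =
      reflexive (≡.cong₂ (λ a b → (pow R q a * qint R q b) * (e R N x k * e R N x a)) (ℕ.m+n∸m≡n k m) twice-k∸)
      where
      twice-k∸ : 2 *ℕ k ∸ (k +ℕ m) ≡ k ∸ m
      twice-k∸ = ≡.trans (ℕ.[m+n]∸[m+o]≡n∸o k (k +ℕ 0) m) (≡.cong (_∸ m) (ℕ.+-identityʳ k))

    closedForm-≡ : ∀ N x i j {lo n} → i ⊔ j ≡ lo → i +ℕ j ∸ 1 ≡ n →
                   closedForm N x i j ≡ ΣRange R lo n (closedTerm N x n)
    closedForm-≡ N x i j ≡.refl ≡.refl = ≡.refl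

    closedForm-zeroʳ : ∀ N x i → closedForm N x i 0 ≈ 0#
    closedForm-zeroʳ N x zero    = trans (+-identityʳ _) (trans (*-congʳ (zeroʳ _)) (zeroˡ _))
    closedForm-zeroʳ N x (suc i) = ΣRange-empty (suc i) (i +ℕ 0) _ (s≤s (ℕ.≤-reflexive (ℕ.+-identityʳ i)))

    private
      closedForm-Δ-< : ∀ N x i t → let j = i +ℕ suc t in
                       Δ (closedForm N x) i j ≈ qdiff i j * (e R N x i * e R N x j)
      closedForm-Δ-< N x i t = begin
        closedForm N x i (suc j) - closedForm N x (suc i) j
          ≈⟨ +-cong (reflexive (closedForm-≡ N x i (suc j) (ℕ.m≤n⇒m⊔n≡n i≤1+j) (≡.trans (≡.cong (_∸ 1) (ℕ.+-suc i j)) (ℕ.+-comm i j))))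
                    (-‿cong (trans (reflexive (closedForm-≡ N x (suc i) j (ℕ.m≤n⇒m⊔n≡n 1+i≤j) (ℕ.+-comm i j)))
                                   (ΣRange-split j (j +ℕ i) F (ℕ.m≤m+n j i)))) ⟩
        ΣRange R (suc j) (j +ℕ i) F - (F j + ΣRange R (suc j) (j +ℕ i) F)
          ≈⟨ solve 2 (λ s a → s :- (a :+ s) := :- a) refl _ (F j) ⟩
        - F j
          ≈⟨ -‿cong (trans (closedTerm-+ N x j i) (reflexive (≡.cong (λ d → (pow R q i * qint R q d) * (e R N x j * e R N x i)) (ℕ.m+n∸m≡n i (suc t))))) ⟩
        - ((pow R q i * qint R q (suc t)) * (e R N x j * e R N x i))
          ≈⟨ solve 3 (λ a y z → :- (a :* (z :* y)) := (:- a) :* (y :* z)) refl _ _ _ ⟩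
        - (pow R q i * qint R q (suc t)) * (e R N x i * e R N x j)
          ≈⟨ *-congʳ (qdiff-+ʳ i (suc t)) ⟨
        qdiff i j * (e R N x i * e R N x j) ∎
        where
        j = i +ℕ suc t
        F = closedTerm N x (j +ℕ i)
        1+i≤j : suc i ≤ j
        1+i≤j = ℕ.≤-trans (s≤s (ℕ.m≤m+n i t)) (ℕ.≤-reflexive (≡.sym (ℕ.+-suc i t)))
        i≤1+j : i ≤ suc j
        i≤1+j = ℕ.≤-trans (ℕ.n≤1+n i) (ℕ.≤-trans 1+i≤j (ℕ.n≤1+n j))

      closedForm-Δ-> : ∀ N x j t → let i = j +ℕ suc t in
                       Δ (closedForm N x) i j ≈ qdiff i j * (e R N x i * e R N x j)
      closedForm-Δ-> N x j t = begin
        closedForm N x i (suc j) - closedForm N x (suc i) j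
          ≈⟨ +-cong (trans (reflexive (closedForm-≡ N x i (suc j) (ℕ.m≥n⇒m⊔n≡m 1+j≤i) (≡.cong (_∸ 1) (ℕ.+-suc i j))))
                           (ΣRange-split i (i +ℕ j) F (ℕ.m≤m+n i j)))
                    (-‿cong (reflexive (closedForm-≡ N x (suc i) j (ℕ.m≥n⇒m⊔n≡m j≤1+i) ≡.refl))) ⟩
        (F i + ΣRange R (suc i) (i +ℕ j) F) - ΣRange R (suc i) (i +ℕ j) F
          ≈⟨ solve 2 (λ a s → (a :+ s) :- s := a) refl (F i) _ ⟩
        F i
          ≈⟨ trans (closedTerm-+ N x i j) (reflexive (≡.cong (λ d → (pow R q j * qint R q d) * (e R N x i * e R N x j)) (ℕ.m+n∸m≡n j (suc t)))) ⟩
        (pow R q j * qint R q (suc t)) * (e R N x i * e R N x j)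
          ≈⟨ *-congʳ (qdiff-+ˡ j (suc t)) ⟨
        qdiff i j * (e R N x i * e R N x j) ∎
        where
        i = j +ℕ suc t
        F = closedTerm N x (i +ℕ j)
        1+j≤i : suc j ≤ i
        1+j≤i = ℕ.≤-trans (s≤s (ℕ.m≤m+n j t)) (ℕ.≤-reflexive (≡.sym (ℕ.+-suc j t)))
        j≤1+i : j ≤ suc i
        j≤1+i = ℕ.≤-trans (ℕ.n≤1+n j) (ℕ.≤-trans 1+j≤i (ℕ.n≤1+n i))

      closedForm-Δ-≡ : ∀ N x i → Δ (closedForm N x) i i ≈ qdiff i i * (e R N x i * e R N x i)
      closedForm-Δ-≡ N x i = begin
        closedForm N x i (suc i) - closedForm N x (suc i) i
          ≡⟨ ≡.cong (_- closedForm N x (suc i) i)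
               (closedForm-≡ N x i (suc i) (ℕ.⊔-comm i (suc i)) (≡.cong (_∸ 1) (ℕ.+-suc i i))) ⟩
        closedForm N x (suc i) i - closedForm N x (suc i) i
          ≈⟨ -‿inverseʳ _ ⟩
        0#
          ≈⟨ trans (*-congʳ (qdiff-self i)) (zeroˡ _) ⟨
        qdiff i i * (e R N x i * e R N x i) ∎

    closedForm-Δ : ∀ N x i j → Δ (closedForm N x) i j ≈ qdiff i j * (e R N x i * e R N x j)
    closedForm-Δ N x i j with compare i j
    ... | less    i k = ≡.subst (λ j → Δ (closedForm N x) i j ≈ qdiff i j * (e R N x i * e R N x j))
                                (ℕ.+-suc i k) (closedForm-Δ-< N x i k)
    ... | equal   i   = closedForm-Δ-≡ N x i
    ... | greater j k = ≡.subst (λ i → Δ (closedForm N x) i j ≈ qdiff i j * (e R N x i * e R N x j))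
                                (ℕ.+-suc j k) (closedForm-Δ-> N x j k)

    insertionSum≈closedForm : ∀ N x i j → insertionSum N x i j ≈ closedForm N x i j
    insertionSum≈closedForm N x = Δ-unique {insertionSum N x} {closedForm N x} (insertionSum-zeroʳ N x) (closedForm-zeroʳ N x)
      (λ i j → trans (insertionSum-Δ N x i j) (sym (closedForm-Δ N x i j)))

    -- Weighted colouring sums

    indicator : Bool → Carrier
    indicator b = if b then 1# else 0#

    if≈indicator* : ∀ b u → (if b then u else 0#) ≈ indicator b * u
    if≈indicator* true  u = sym (*-identityˡ u)
    if≈indicator* false u = sym (zeroˡ u)

    pairWeight : ∀ {N n} → Graph n → Colouring N n → Fin n Product.× Fin n → Carrier
    pairWeight G κ p = if G (proj₁ p) (proj₂ p) then ascWeight (lookup κ (proj₁ p)) (lookup κ (proj₂ p)) else 1#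

    colouringWeight : ∀ {N n} → Graph n → Colouring N n → Carrier
    colouringWeight {n = n} G κ = Π R (map (pairWeight G κ) (pairs n))

    -- X_G with vertex-dependent variables (vertex i coloured c contributes F i c): deleting a
    -- vertex makes the variables of its neighbours depend on its colour.
    weightedSum : ∀ N n → Graph n → (Fin n → Fin N → Carrier) → Carrier
    weightedSum N n G F =
      Σ R (map (λ κ → colouringWeight G κ * Π R (map (λ i → F i (lookup κ i)) (allFin n))) (allVecs (allFin N) n))

    private
      indicator-∧ : ∀ a b → indicator (a ∧ b) ≈ indicator a * indicator b
      indicator-∧ true  b = sym (*-identityˡ _)
      indicator-∧ false b = sym (zeroˡ _)

      all∧count≈Π : ∀ {a p} {A : Set a} {P : Pred A p} (P? : U.Decidable P) (t : A → Bool) (f : A → Carrier) →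
        (∀ x → indicator (t x) * (if does (P? x) then q else 1#) ≈ f x) →
        ∀ xs → indicator (foldr _∧_ true (map t xs)) * pow R q (length (filter P? xs)) ≈ Π R (map f xs)
      all∧count≈Π P? t f tP≈f []       = *-identityˡ 1#
      all∧count≈Π P? t f tP≈f (x ∷ xs) with does (P? x) | tP≈f x
      ... | true  | tPx≈fx = begin
        indicator (t x ∧ all) * (q * pow R q (length (filter P? xs)))
          ≈⟨ *-congʳ (indicator-∧ (t x) all) ⟩
        (indicator (t x) * indicator all) * (q * pow R q (length (filter P? xs)))
          ≈⟨ interchange _ _ _ _ ⟩
        (indicator (t x) * q) * (indicator all * pow R q (length (filter P? xs)))
          ≈⟨ *-cong tPx≈fx (all∧count≈Π P? t f tP≈f xs) ⟩
        f x * Π R (map f xs) ∎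
        where all = foldr _∧_ true (map t xs)
      ... | false | tPx≈fx = begin
        indicator (t x ∧ all) * pow R q (length (filter P? xs))
          ≈⟨ trans (*-congʳ (indicator-∧ (t x) all)) (*-assoc _ _ _) ⟩
        indicator (t x) * (indicator all * pow R q (length (filter P? xs)))
          ≈⟨ *-cong (trans (sym (*-identityʳ _)) tPx≈fx) (all∧count≈Π P? t f tP≈f xs) ⟩
        f x * Π R (map f xs) ∎
        where all = foldr _∧_ true (map t xs)

      ascWeight-spec : ∀ {N} (y z : Fin N) →
        indicator (not ⌊ y Fin.≟ z ⌋) * (if does ((toℕ y <ᵇ toℕ z) Bool.≟ true) then q else 1#) ≈ ascWeight y z
      ascWeight-spec zero    zero    = zeroˡ _
      ascWeight-spec zero    (suc z) = *-identityˡ q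
      ascWeight-spec (suc y) zero    = *-identityˡ 1#
      ascWeight-spec (suc y) (suc z) with y Fin.≟ z | ascWeight-spec y z
      ... | yes _ | spec = spec
      ... | no  _ | spec = spec

      pairWeight-spec : ∀ {N n} (G : Graph n) (κ : Colouring N n) i j →
        indicator (not (G i j) ∨ not ⌊ lookup κ i Fin.≟ lookup κ j ⌋) *
          (if does ((G i j ∧ (toℕ (lookup κ i) <ᵇ toℕ (lookup κ j))) Bool.≟ true) then q else 1#)
        ≈ pairWeight G κ (i , j)
      pairWeight-spec G κ i j with G i j
      ... | true  = ascWeight-spec (lookup κ i) (lookup κ j)
      ... | false = *-identityˡ 1#

    X≈weightedSum : ∀ N x {n} (G : Graph n) → X R N x q G ≈ weightedSum N n G (λ _ → x)
    X≈weightedSum N x {n} G = Σ-map-cong (allVecs (allFin N) n) λ κ → begin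
      (if proper G κ then pow R q (asc G κ) * M κ else 0#)  ≈⟨ if≈indicator* (proper G κ) _ ⟩
      indicator (proper G κ) * (pow R q (asc G κ) * M κ)    ≈⟨ *-assoc _ _ _ ⟨
      (indicator (proper G κ) * pow R q (asc G κ)) * M κ
        ≈⟨ *-congʳ (all∧count≈Π _ _ (pairWeight G κ) (λ { (i , j) → pairWeight-spec G κ i j }) (pairs n)) ⟩
      colouringWeight G κ * M κ ∎
      where
      M : Colouring N n → Carrier
      M κ = Π R (map (λ i → x (lookup κ i)) (allFin n))

    weightedSum-cong : ∀ N n (G : Graph n) {F F′ : Fin n → Fin N → Carrier} →
                       (∀ i c → F i c ≈ F′ i c) → weightedSum N n G F ≈ weightedSum N n G F′
    weightedSum-cong N n G F≈F′ =
      Σ-map-cong (allVecs (allFin N) n) (λ κ → *-congˡ (Π-map-cong (allFin n) (λ i → F≈F′ i (lookup κ i))))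

    weightedSum-empty : ∀ N (G : Graph 0) F → weightedSum N 0 G F ≈ 1#
    weightedSum-empty N G F = trans (+-identityʳ _) (*-identityˡ 1#)

    colouringWeight-∷ : ∀ {N n} (G : Graph (suc n)) y (κ : Colouring N n) →
      colouringWeight G (y ∷ κ) ≈
        Π R (map (λ j → if G zero (suc j) then ascWeight y (lookup κ j) else 1#) (allFin n))
          * colouringWeight (λ i j → G (suc i) (suc j)) κ
    colouringWeight-∷ {n = n} G y κ = begin
      Π R (map w (pairs (suc n)))
        ≡⟨ ≡.cong (Π R ∘ map w) (pairs-suc n) ⟩
      Π R (map w (map (λ j → zero , suc j) (allFin n) ++ map (Product.map suc suc) (pairs n)))
        ≡⟨ ≡.cong (Π R) (List.map-++ w (map (λ j → zero , suc j) (allFin n)) _) ⟩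
      Π R (map w (map (λ j → zero , suc j) (allFin n)) ++ map w (map (Product.map suc suc) (pairs n)))
        ≈⟨ Π-++ (map w (map (λ j → zero , suc j) (allFin n))) _ ⟩
      Π R (map w (map (λ j → zero , suc j) (allFin n))) * Π R (map w (map (Product.map suc suc) (pairs n)))
        ≡⟨ ≡.cong₂ (λ a b → Π R a * Π R b) (≡.sym (List.map-∘ (allFin n))) (≡.sym (List.map-∘ (pairs n))) ⟩
      Π R (map (w ∘ (λ j → zero , suc j)) (allFin n)) * colouringWeight (λ i j → G (suc i) (suc j)) κ ∎
      where w = pairWeight G (y ∷ κ)

    weightedSum-peel : ∀ N n (G : Graph (suc n)) (F : Fin (suc n) → Fin N → Carrier) →
      weightedSum N (suc n) G F ≈
        sum (λ y → F zero y * weightedSum N n (λ i j → G (suc i) (suc j))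
                                 (λ j c → F (suc j) c * (if G zero (suc j) then ascWeight y c else 1#)))
    weightedSum-peel N n G F = begin
      Σ R (map term (concatMap (λ y → map (y ∷_) κs) (allFin N)))
        ≈⟨ Σ-concatMap (λ y → map (y ∷_) κs) term (allFin N) ⟩
      Σ R (map (λ y → Σ R (map term (map (y ∷_) κs))) (allFin N))
        ≈⟨ Σ-allFin (λ y → Σ R (map term (map (y ∷_) κs))) ⟩
      sum (λ y → Σ R (map term (map (y ∷_) κs)))
        ≈⟨ sum-cong-≋ (λ y → trans (reflexive (≡.cong (Σ R) (≡.sym (List.map-∘ κs))))
                                   (trans (Σ-map-cong κs (term-cons y)) (Σ-map-*ˡ κs (F zero y) (term′ y)))) ⟩
      sum (λ y → F zero y * Σ R (map (term′ y) κs)) ∎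
      where
      κs = allVecs (allFin N) n
      G⁺ : Graph n
      G⁺ i j = G (suc i) (suc j)
      term : Colouring N (suc n) → Carrier
      term κ = colouringWeight G κ * Π R (map (λ i → F i (lookup κ i)) (allFin (suc n)))
      edge₀ : Fin N → Colouring N n → Fin n → Carrier
      edge₀ y κ j = if G zero (suc j) then ascWeight y (lookup κ j) else 1#
      term′ : Fin N → Colouring N n → Carrier
      term′ y κ = colouringWeight G⁺ κ * Π R (map (λ j → F (suc j) (lookup κ j) * edge₀ y κ j) (allFin n))
      term-cons : ∀ y κ → term (y ∷ κ) ≈ F zero y * term′ y κ
      term-cons y κ = begin
        colouringWeight G (y ∷ κ) * Π R (map (λ i → F i (lookup (y ∷ κ) i)) (allFin (suc n)))
          ≈⟨ *-cong (colouringWeight-∷ G y κ) (reflexive (≡.cong (Π R) (map-allFin-suc (λ i → F i (lookup (y ∷ κ) i))))) ⟩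
        (E * W) * (F zero y * Fs)
          ≈⟨ solve 4 (λ E W F₀ Fs → (E :* W) :* (F₀ :* Fs) := F₀ :* (W :* (Fs :* E))) refl E W (F zero y) Fs ⟩
        F zero y * (W * (Fs * E))
          ≈⟨ *-congˡ (*-congˡ (Π-map-* (allFin n) (λ j → F (suc j) (lookup κ j)) (edge₀ y κ))) ⟨
        F zero y * term′ y κ ∎
        where
        E = Π R (map (edge₀ y κ) (allFin n))
        W = colouringWeight G⁺ κ
        Fs = Π R (map (λ j → F (suc j) (lookup κ j)) (allFin n))

    complete : ∀ {n} → Graph n
    complete _ _ = true

    weightedSum-complete : ∀ N m (h : Fin N → Carrier) → weightedSum N m complete (λ _ → h) ≈ qfact R q m * e R N h m
    weightedSum-complete N zero    h = trans (weightedSum-empty N complete (λ _ → h)) (sym (trans (*-identityˡ _) (e-zero N h)))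
    weightedSum-complete N (suc m) h = begin
      weightedSum N (suc m) complete (λ _ → h)
        ≈⟨ weightedSum-peel N m complete (λ _ → h) ⟩
      sum (λ y → h y * weightedSum N m complete (λ _ c → h c * ascWeight y c))
        ≈⟨ sum-cong-≋ (λ y → *-congˡ (weightedSum-complete N m (λ c → h c * ascWeight y c))) ⟩
      sum (λ y → h y * (qfact R q m * eRight N h y m))
        ≈⟨ trans (sum-cong-≋ (λ y → x∙yz≈y∙xz (h y) _ _)) (sym (*-distribˡ-sum (qfact R q m) (λ y → h y * eRight N h y m))) ⟩
      qfact R q m * sum (λ y → h y * eRight N h y m)
        ≈⟨ *-congˡ (insertion N h m) ⟩
      qfact R q m * (qint R q (suc m) * e R N h (suc m))
        ≈⟨ trans (x∙yz≈y∙xz _ _ _) (sym (*-assoc _ _ _)) ⟩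
      qfact R q (suc m) * e R N h (suc m) ∎

    -- Exchange the sums and apply the insertion identity to the weights g · ascWeight(·, c).
    insertion-under-sum : ∀ N α (g v : Fin N → Carrier) →
      sum (λ y → g y * sum (λ c → (g c * ascWeight y c) * (eLeft N (λ z → g z * ascWeight y z) c α * v c)))
      ≈ qint R q (suc α) * sum (λ c → g c * (eLeft N g c (suc α) * v c))
    insertion-under-sum N α g v = begin
      sum (λ y → g y * sum (term y))
        ≈⟨ sum-cong-≋ (λ y → *-distribˡ-sum (g y) (term y)) ⟩
      sum (λ y → sum (λ c → g y * term y c))
        ≈⟨ ∑-comm (λ y c → g y * term y c) ⟩
      sum (λ c → sum (λ y → g y * term y c))
        ≈⟨ sum-cong-≋ (λ c → trans (sum-cong-≋ (λ y → regroup y c)) (sym (*-distribˡ-sum (g c * v c) (λ y → h c y * eRight N (h c) y α)))) ⟩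
      sum (λ c → (g c * v c) * sum (λ y → h c y * eRight N (h c) y α))
        ≈⟨ sum-cong-≋ (λ c → *-congˡ (insertion N (h c) α)) ⟩
      sum (λ c → (g c * v c) * (qint R q (suc α) * eLeft N g c (suc α)))
        ≈⟨ sum-cong-≋ (λ c → solve 4 (λ a b Q E → (a :* b) :* (Q :* E) := Q :* (a :* (E :* b))) refl (g c) (v c) _ _) ⟩
      sum (λ c → qint R q (suc α) * (g c * (eLeft N g c (suc α) * v c)))
        ≈⟨ *-distribˡ-sum (qint R q (suc α)) (λ c → g c * (eLeft N g c (suc α) * v c)) ⟨
      qint R q (suc α) * sum (λ c → g c * (eLeft N g c (suc α) * v c)) ∎
      where
      term : Fin N → Fin N → Carrier
      term y c = (g c * ascWeight y c) * (eLeft N (λ z → g z * ascWeight y z) c α * v c)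
      h : Fin N → Fin N → Carrier
      h c y = g y * ascWeight y c
      regroup : ∀ y c → g y * term y c ≈ (g c * v c) * (h c y * eRight N (h c) y α)
      regroup y c = begin
        g y * ((g c * ascWeight y c) * (eLeft N (λ z → g z * ascWeight y z) c α * v c))
          ≈⟨ solve 5 (λ gy gc t a b → gy :* ((gc :* t) :* (a :* b)) := (gc :* b) :* ((gy :* t) :* a)) refl (g y) (g c) _ _ _ ⟩
        (g c * v c) * (h c y * eLeft N (λ z → g z * ascWeight y z) c α)
          ≈⟨ *-congˡ (*-congˡ (e-cong N (λ z → solve 3 (λ u v w → (u :* v) :* w := (u :* w) :* v) refl (g z) _ _) α)) ⟩
        (g c * v c) * (h c y * eRight N (h c) y α) ∎

    blockWeights : ∀ {N n} → ℕ → (Fin N → Carrier) → (Fin N → Carrier) → Fin n → Fin N → Carrier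
    blockWeights α g x j c = if toℕ j <ᵇ suc α then g c else x c

    weightedSum-Kab : ∀ N α β (g x : Fin N → Carrier) →
      weightedSum N (α +ℕ suc β) (Kab (suc α) (suc β)) (blockWeights α g x) ≈
        (qfact R q α * qfact R q β) * sum (λ c → g c * (eLeft N g c α * eRight N x c β))
    weightedSum-Kab N zero β g x = begin
      weightedSum N (suc β) (Kab 1 (suc β)) (blockWeights 0 g x)
        ≈⟨ weightedSum-peel N β (Kab 1 (suc β)) (blockWeights 0 g x) ⟩
      sum (λ y → g y * weightedSum N β complete (λ _ c → x c * ascWeight y c))
        ≈⟨ sum-cong-≋ (λ y → *-congˡ (weightedSum-complete N β (λ c → x c * ascWeight y c))) ⟩
      sum (λ y → g y * (qfact R q β * eRight N x y β))
        ≈⟨ trans (sum-cong-≋ (λ y → x∙yz≈y∙xz (g y) _ _)) (sym (*-distribˡ-sum (qfact R q β) (λ y → g y * eRight N x y β))) ⟩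
      qfact R q β * sum (λ y → g y * eRight N x y β)
        ≈⟨ *-cong (sym (*-identityˡ _)) (sum-cong-≋ (λ c → *-congˡ (sym (trans (*-congʳ (e-zero N (λ y → g y * ascWeight y c))) (*-identityˡ _))))) ⟩
      (qfact R q 0 * qfact R q β) * sum (λ c → g c * (eLeft N g c 0 * eRight N x c β)) ∎
    weightedSum-Kab N (suc α) β g x = begin
      weightedSum N (suc (α +ℕ suc β)) (Kab (suc (suc α)) (suc β)) (blockWeights (suc α) g x)
        ≈⟨ weightedSum-peel N (α +ℕ suc β) (Kab (suc (suc α)) (suc β)) (blockWeights (suc α) g x) ⟩
      sum (λ y → g y * weightedSum N (α +ℕ suc β) (Kab (suc α) (suc β))
                         (λ j c → blockWeights (suc α) g x (suc j) c * (if Kab (suc (suc α)) (suc β) zero (suc j) then ascWeight y c else 1#)))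
        ≈⟨ sum-cong-≋ (λ y → *-congˡ (trans (weightedSum-cong N _ (Kab (suc α) (suc β)) (λ j c → first-block (toℕ j <ᵇ suc α) (g c) (x c) (ascWeight y c)))
                                            (weightedSum-Kab N α β (λ c → g c * ascWeight y c) x))) ⟩
      sum (λ y → g y * (K * sum (ih-term y)))
        ≈⟨ trans (sum-cong-≋ (λ y → x∙yz≈y∙xz (g y) K _)) (sym (*-distribˡ-sum K (λ y → g y * sum (ih-term y)))) ⟩
      K * sum (λ y → g y * sum (ih-term y))
        ≈⟨ *-congˡ (insertion-under-sum N α g (λ c → eRight N x c β)) ⟩
      K * (qint R q (suc α) * sum (λ c → g c * (eLeft N g c (suc α) * eRight N x c β)))
        ≈⟨ solve 4 (λ A B Q s → (A :* B) :* (Q :* s) := (Q :* A :* B) :* s) refl (qfact R q α) (qfact R q β) _ _ ⟩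
      (qfact R q (suc α) * qfact R q β) * sum (λ c → g c * (eLeft N g c (suc α) * eRight N x c β)) ∎
      where
      K = qfact R q α * qfact R q β
      ih-term : Fin N → Fin N → Carrier
      ih-term y c = (g c * ascWeight y c) * (eLeft N (λ z → g z * ascWeight y z) c α * eRight N x c β)
      first-block : ∀ b gc xc t → (if b then gc else xc) * (if b ∨ false then t else 1#) ≈ (if b then gc * t else xc)
      first-block true  gc xc t = refl
      first-block false gc xc t = *-identityʳ xc

open import Data.Nat using (_+_; _*_)

-- The identity holds for all a, b ≥ 1; only a, b ≠ 0 is used.
corollary4p14 : ∀ {c ℓ} (R : CommutativeRing c ℓ) (a b : ℕ) → 2 ≤ a → 2 ≤ b →
    (N : ℕ) (x : Fin N → CommutativeRing.Carrier R) (q : CommutativeRing.Carrier R) →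
    CommutativeRing._≈_ R
      (X R N x q (Kab a b))
      (CommutativeRing._*_ R
        (CommutativeRing._*_ R (qfact R q (a ∸ 1)) (qfact R q (b ∸ 1)))
        (ΣRange R (a ⊔ b) (a + b ∸ 1) (λ k →
          CommutativeRing._*_ R
            (CommutativeRing._*_ R (pow R q ((a + b ∸ 1) ∸ k)) (qint R q (2 * k ∸ (a + b ∸ 1))))
            (CommutativeRing._*_ R (e R N x k) (e R N x ((a + b ∸ 1) ∸ k))))))
corollary4p14 R (suc α) (suc β) (s≤s _) (s≤s _) N x q = begin
  X R N x q (Kab (suc α) (suc β))
    ≈⟨ X≈weightedSum R q N x (Kab (suc α) (suc β)) ⟩
  weightedSum R q N (α +ℕ suc β) (Kab (suc α) (suc β)) (λ _ → x)
    ≈⟨ weightedSum-cong R q N (α +ℕ suc β) (Kab (suc α) (suc β)) {λ _ → x} (λ i c → ℛ.reflexive (≡.sym (if-eta (toℕ i <ᵇ suc α)))) ⟩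
  weightedSum R q N (α +ℕ suc β) (Kab (suc α) (suc β)) (blockWeights R q α x x)
    ≈⟨ weightedSum-Kab R q N α β x x ⟩
  (qfact R q α ℛ.* qfact R q β) ℛ.* insertionSum R q N x (suc α) (suc β)
    ≈⟨ ℛ.*-congˡ (insertionSum≈closedForm R q N x (suc α) (suc β)) ⟩
  (qfact R q α ℛ.* qfact R q β) ℛ.* closedForm R q N x (suc α) (suc β) ∎
  where
  module ℛ = CommutativeRing R
  open import Relation.Binary.Reasoning.Setoid ℛ.setoid
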